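{- For every two graphs $H$ and $G$ such that $H$ is connected and has at least one edge, $\mathrm{cover}_H(G)\leq \mathrm{cover}_{H^+}(G^*)$.
   Context: Graphs are finite, loopless, may have multiple edges; $\mathrm{mdeg}_G(v)$ is the number of edges incident with $v$ counting multiplicities. $G$ contains $H$ as an immersion if there is $(\phi,\psi)$ with $\phi:V(H)\to V(G)$ injective and $\psi$ mapping each edge of $H$ (each copy of a multiple edge separately) with endpoints $u,v$ to a path of $G$ between $\phi(u),\phi(v)$, distinct edges going to edge-disjoint paths. $\mathrm{cover}_H(G)$ is the minimum size of a set $C\subseteq E(G)$ such that $G\setminus C$ does not contain $H$ as an immersion. $H^+$ is obtained from $H$ by adding, for every vertex $v$, new vertices $v',v''$, an edge $\{v',v''\}$ of multiplicity 2, and edges $\{v,v'\},\{v,v''\}$ of multiplicity 1. $G^*$ is obtained from $G$ by adding, for every vertex $v$ and every $i\in\{1,\dots,\mathrm{mdeg}_G(v)\}$, new vertices $v'_i,v''_i$, an edge $\{v'_i,v''_i\}$ of multiplicity 2, and edges $\{v,v'_i\},\{v,v''_i\}$ of multiplicity 1. -}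

module Defs where

open import Data.Nat using (ℕ; zero; suc; _+_; _≤_)
open import Data.Fin using (Fin; _↑ˡ_; _↑ʳ_; _≟_)
open import Data.Fin.Subset using (Subset; ∣_∣)
open import Data.Bool using (Bool; true; false; _∨_)
open import Data.List using (List; []; _∷_; _++_; length; lookup; map; concatMap; replicate; allFin)
open import Data.Nat.ListAction using (sum)
open import Data.List.Membership.Propositional using (_∈_)
open import Data.List.Relation.Unary.Unique.Propositional using (Unique)
open import Data.Vec using (Vec; []; _∷_)
open import Data.Product using (Σ; _×_; _,_; proj₁; proj₂; ∃)
open import Data.Sum using (_⊎_)
open import Data.Empty using (⊥)
open import Relation.Nullary using (¬_)
open import Relation.Nullary.Decidable using (⌊_⌋)
open import Relation.Binary.PropositionalEquality using (_≡_; _≢_)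
open import Function.Definitions using (Injective)

-- Each list entry is a separate edge (parallel edges = repeated
-- entries), identified by its position Fin (length edges).
record Graph : Set where
  constructor mkGraph
  field
    n     : ℕ
    edges : List (Fin n × Fin n)
open Graph public

V : Graph → Set
V G = Fin (n G)

E : Graph → Set
E G = Fin (length (edges G))

ends : (G : Graph) → E G → V G × V G
ends G e = lookup (edges G) e

Loopless : Graph → Set
Loopless G = ∀ (e : E G) → proj₁ (ends G e) ≢ proj₂ (ends G e)

Joins : (G : Graph) → E G → V G → V G → Set
Joins G e u w = (ends G e ≡ (u , w)) ⊎ (ends G e ≡ (w , u))

data Walk (G : Graph) : V G → V G → List (V G) → List (E G) → Set where
  nil  : ∀ {u} → Walk G u u (u ∷ []) []
  cons : ∀ {u w v vs es} (e : E G) → Joins G e u w →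
         Walk G w v vs es → Walk G u v (u ∷ vs) (e ∷ es)

Path : (G : Graph) → V G → V G → List (E G) → Set
Path G u v es = Σ (List (V G)) λ vs → Walk G u v vs es × Unique vs

Connected : Graph → Set
Connected G = ∀ (u v : V G) → ∃ λ es → Σ (List (V G)) λ vs → Walk G u v vs es

HasEdge : Graph → Set
HasEdge G = E G

EdgeDisjoint : ∀ {A : Set} → List A → List A → Set
EdgeDisjoint xs ys = ∀ {x} → x ∈ xs → x ∈ ys → ⊥

Immersion : Graph → Graph → Set
Immersion H G =
  Σ (V H → V G) λ φ → Σ (E H → List (E G)) λ ψ →
    Injective _≡_ _≡_ φ
    × (∀ (f : E H) → Path G (φ (proj₁ (ends H f))) (φ (proj₂ (ends H f))) (ψ f))
    × (∀ (f f' : E H) → f ≢ f' → EdgeDisjoint (ψ f) (ψ f'))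

removeEdges : ∀ {A : Set} (xs : List A) → Subset (length xs) → List A
removeEdges []       []           = []
removeEdges (x ∷ xs) (true ∷ c)   = removeEdges xs c
removeEdges (x ∷ xs) (false ∷ c)  = x ∷ removeEdges xs c

_∖_ : (G : Graph) → Subset (length (edges G)) → Graph
G ∖ C = mkGraph (n G) (removeEdges (edges G) C)

IsCover : (H G : Graph) → Subset (length (edges G)) → Set
IsCover H G C = ¬ Immersion H (G ∖ C)

IsCoverNumber : (H G : Graph) → ℕ → Set
IsCoverNumber H G k =
  (Σ (Subset (length (edges G))) λ C → IsCover H G C × ∣ C ∣ ≡ k)
  × (∀ C → IsCover H G C → k ≤ ∣ C ∣)

mdeg : (G : Graph) → V G → ℕ
mdeg G v = sum (map (λ p → if⌊ p ⌋) (edges G))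
  where
    if⌊_⌋ : V G × V G → ℕ
    if⌊ (a , b) ⌋ with ⌊ v ≟ a ⌋ ∨ ⌊ v ≟ b ⌋
    ... | true  = 1
    ... | false = 0

attach : (G : Graph) → List (V G) → Graph
attach G att = mkGraph (n G + (d + d)) (map old (edges G) ++ concatMap gadget (allFin d))
  where
    d = length att
    old : V G × V G → Fin (n G + (d + d)) × Fin (n G + (d + d))
    old (a , b) = (a ↑ˡ (d + d)) , (b ↑ˡ (d + d))
    gadget : Fin d → List (Fin (n G + (d + d)) × Fin (n G + (d + d)))
    gadget j =
      let w  = lookup att j ↑ˡ (d + d)
          w' = n G ↑ʳ (j ↑ˡ d)
          w″ = n G ↑ʳ (d ↑ʳ j)
      in (w' , w″) ∷ (w' , w″) ∷ (w , w') ∷ (w , w″) ∷ []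

_⁺ : Graph → Graph
H ⁺ = attach H (allFin (n H))

_* : Graph → Graph
G * = attach G (concatMap (λ v → replicate (mdeg G v) v) (allFin (n G)))

-- Given a set C' of edges of G* meeting every immersion of H⁺, call a vertex v of G dead when
-- each of the mdeg v gadgets hanging at v in G* contains an edge of C', and let C consist of the
-- edges of G lying in C' together with all edges at dead vertices.  The at most mdeg v edges at a
-- dead vertex v are paid for by the mdeg v distinct edges of C' inside its gadgets, so ∣C∣ ≤ ∣C'∣.
-- If H still immersed in G ∖ C, every vertex of H (which lies on an edge, H being connected with an
-- edge) would be sent to a vertex on a surviving edge, hence to a live vertex; sending its two
-- gadget vertices to those of an untouched gadget there extends the immersion to one of H⁺ in
-- G* ∖ C', which is impossible.

module Submission where

open import Defs
open import Data.Nat using (ℕ; zero; suc; _+_; _*_; _≤_; z≤n; s≤s)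
open import Data.Nat.Properties as ℕ
  using (≤-refl; ≤-trans; ≤-reflexive; +-mono-≤; +-monoʳ-≤; m≤m+n; m≤n+m; *-comm; *-identityʳ)
open import Data.Fin as F using (Fin; zero; suc; _↑ˡ_; _↑ʳ_; toℕ; cast)
open import Data.Fin.Properties
  using (any?; suc-injective; toℕ-injective; toℕ-cast; ↑ˡ-injective; ↑ʳ-injective;
         splitAt-↑ˡ; splitAt-↑ʳ; splitAt-join; join-splitAt)
open import Data.Fin.Subset using (Subset; ∣_∣)
open import Data.Bool as Bool using (Bool; true; false; _∨_; not)
open import Data.Bool.Properties using (∨-zeroʳ; ¬-not)
open import Data.List using (List; []; _∷_; _++_; length; map; concatMap; replicate; allFin; tabulate; lookup)
open import Data.List.Properties using (length-tabulate; map-cong)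
open import Data.Nat.ListAction using (sum)
open import Data.Vec as Vec using ([]; _∷_)
open import Data.Vec.Properties using (lookup∘tabulate)
open import Data.Product using (Σ; _×_; _,_; proj₁; proj₂; ∃)
open import Data.Sum as Sum using (_⊎_; inj₁; inj₂)
open import Data.Sum.Properties using (inj₁-injective; inj₂-injective)
open import Data.Empty using (⊥; ⊥-elim)
open import Relation.Nullary using (¬_; yes; no; Dec; ¬?; _×-dec_)
open import Relation.Nullary.Decidable using (⌊_⌋)
open import Data.List.Relation.Unary.Any using (here)
open import Data.List.Relation.Unary.All using ([]; _∷_)
open import Data.List.Relation.Unary.AllPairs using ([]; _∷_)
open import Data.List.Membership.Propositional.Properties using (∈-map⁻)
open import Data.List.Relation.Unary.Unique.Propositional.Properties as Unique using ()
open import Relation.Binary.PropositionalEquality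
open import Function.Base using (id; _∘_)
open import Function.Definitions using (Injective)
open import Algebra.Properties.CommutativeMonoid.Sum ℕ.+-0-commutativeMonoid
  using (sum-syntax; sum-cong-≗; ∑-distrib-+; ∑-comm)
open import Algebra.Properties.Semiring.Sum ℕ.+-*-semiring using (*-distribˡ-sum)

private
  variable
    A B : Set

-- Positions in lists

posˡ : (xs ys : List A) → Fin (length xs) → Fin (length (xs ++ ys))
posˡ (x ∷ xs) ys zero    = zero
posˡ (x ∷ xs) ys (suc i) = suc (posˡ xs ys i)

posʳ : (xs ys : List A) → Fin (length ys) → Fin (length (xs ++ ys))
posʳ []       ys j = j
posʳ (x ∷ xs) ys j = suc (posʳ xs ys j)

lookup-posˡ : (xs ys : List A) (i : Fin (length xs)) → lookup (xs ++ ys) (posˡ xs ys i) ≡ lookup xs i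
lookup-posˡ (x ∷ xs) ys zero    = refl
lookup-posˡ (x ∷ xs) ys (suc i) = lookup-posˡ xs ys i

lookup-posʳ : (xs ys : List A) (j : Fin (length ys)) → lookup (xs ++ ys) (posʳ xs ys j) ≡ lookup ys j
lookup-posʳ []       ys j = refl
lookup-posʳ (x ∷ xs) ys j = lookup-posʳ xs ys j

posˡ-injective : (xs ys : List A) → Injective _≡_ _≡_ (posˡ xs ys)
posˡ-injective (x ∷ xs) ys {zero}  {zero}  eq = refl
posˡ-injective (x ∷ xs) ys {suc i} {suc j} eq = cong suc (posˡ-injective xs ys (suc-injective eq))

posʳ-injective : (xs ys : List A) → Injective _≡_ _≡_ (posʳ xs ys)
posʳ-injective []       ys eq = eq
posʳ-injective (x ∷ xs) ys eq = posʳ-injective xs ys (suc-injective eq)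

posˡ≢posʳ : (xs ys : List A) (i : Fin (length xs)) (j : Fin (length ys)) → posˡ xs ys i ≢ posʳ xs ys j
posˡ≢posʳ (x ∷ xs) ys (suc i) j eq = posˡ≢posʳ xs ys i j (suc-injective eq)

data ++-View (xs ys : List A) : Fin (length (xs ++ ys)) → Set where
  inˡ : ∀ i → ++-View xs ys (posˡ xs ys i)
  inʳ : ∀ j → ++-View xs ys (posʳ xs ys j)

++-view : (xs ys : List A) (p : Fin (length (xs ++ ys))) → ++-View xs ys p
++-view []       ys p       = inʳ p
++-view (x ∷ xs) ys zero    = inˡ zero
++-view (x ∷ xs) ys (suc p) with ++-view xs ys p
... | inˡ i = inˡ (suc i)
... | inʳ j = inʳ j

posᵐ : (f : A → B) (xs : List A) → Fin (length xs) → Fin (length (map f xs))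
posᵐ f (x ∷ xs) zero    = zero
posᵐ f (x ∷ xs) (suc i) = suc (posᵐ f xs i)

lookup-posᵐ : (f : A → B) (xs : List A) (i : Fin (length xs)) → lookup (map f xs) (posᵐ f xs i) ≡ f (lookup xs i)
lookup-posᵐ f (x ∷ xs) zero    = refl
lookup-posᵐ f (x ∷ xs) (suc i) = lookup-posᵐ f xs i

posᵐ-injective : (f : A → B) (xs : List A) → Injective _≡_ _≡_ (posᵐ f xs)
posᵐ-injective f (x ∷ xs) {zero}  {zero}  eq = refl
posᵐ-injective f (x ∷ xs) {suc i} {suc j} eq = cong suc (posᵐ-injective f xs (suc-injective eq))

data map-View (f : A → B) (xs : List A) : Fin (length (map f xs)) → Set where
  at : ∀ i → map-View f xs (posᵐ f xs i)

map-view : (f : A → B) (xs : List A) (p : Fin (length (map f xs))) → map-View f xs p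
map-view f (x ∷ xs) zero    = at zero
map-view f (x ∷ xs) (suc p) with map-view f xs p
... | at i = at (suc i)

posᶜ : ∀ {n} (f : A → List B) (g : Fin n → A) (j : Fin n) → Fin (length (f (g j))) →
       Fin (length (concatMap f (tabulate g)))
posᶜ f g zero    k = posˡ (f (g zero)) _ k
posᶜ f g (suc j) k = posʳ (f (g zero)) _ (posᶜ f (λ i → g (suc i)) j k)

lookup-posᶜ : ∀ {n} (f : A → List B) (g : Fin n → A) j k →
              lookup (concatMap f (tabulate g)) (posᶜ f g j k) ≡ lookup (f (g j)) k
lookup-posᶜ f g zero    k = lookup-posˡ (f (g zero)) _ k
lookup-posᶜ f g (suc j) k =
  trans (lookup-posʳ (f (g zero)) _ _) (lookup-posᶜ f (λ i → g (suc i)) j k)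

posᶜ-injective : ∀ {n} (f : A → List B) (g : Fin n → A) {j j' k k'} →
                 posᶜ f g j k ≡ posᶜ f g j' k' → j ≡ j' × toℕ k ≡ toℕ k'
posᶜ-injective f g {zero}  {zero}  eq = refl , cong toℕ (posˡ-injective (f (g zero)) _ eq)
posᶜ-injective f g {zero}  {suc j'} eq = ⊥-elim (posˡ≢posʳ (f (g zero)) _ _ _ eq)
posᶜ-injective f g {suc j} {zero}  eq = ⊥-elim (posˡ≢posʳ (f (g zero)) _ _ _ (sym eq))
posᶜ-injective f g {suc j} {suc j'} eq
  with posᶜ-injective f (λ i → g (suc i)) {j} {j'} (posʳ-injective (f (g zero)) _ eq)
... | j≡j' , k≡k' = cong suc j≡j' , k≡k'

data concatMap-View {n} (f : A → List B) (g : Fin n → A) : Fin (length (concatMap f (tabulate g))) → Set where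
  at : ∀ j k → concatMap-View f g (posᶜ f g j k)

concatMap-view : ∀ {n} (f : A → List B) (g : Fin n → A) p → concatMap-View f g p
concatMap-view {n = suc n} f g p with ++-view (f (g zero)) (concatMap f (tabulate (λ i → g (suc i)))) p
... | inˡ k = at zero k
... | inʳ q with concatMap-view f (λ i → g (suc i)) q
...   | at j k = at (suc j) k

kept : (xs : List A) (c : Subset (length xs)) (i : Fin (length xs)) →
       Vec.lookup c i ≡ false → Fin (length (removeEdges xs c))
kept (x ∷ xs) (false ∷ c) zero    _ = zero
kept (x ∷ xs) (true ∷ c)  (suc i) p = kept xs c i p
kept (x ∷ xs) (false ∷ c) (suc i) p = suc (kept xs c i p)

lookup-kept : (xs : List A) (c : Subset (length xs)) → ∀ i p →
              lookup (removeEdges xs c) (kept xs c i p) ≡ lookup xs i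
lookup-kept (x ∷ xs) (false ∷ c) zero    _ = refl
lookup-kept (x ∷ xs) (true ∷ c)  (suc i) p = lookup-kept xs c i p
lookup-kept (x ∷ xs) (false ∷ c) (suc i) p = lookup-kept xs c i p

kept-injective : (xs : List A) (c : Subset (length xs)) {i j : Fin (length xs)} → ∀ {p q} →
                 kept xs c i p ≡ kept xs c j q → i ≡ j
kept-injective (x ∷ xs) (false ∷ c) {zero}  {zero}  eq = refl
kept-injective (x ∷ xs) (true ∷ c)  {suc i} {suc j} eq = cong suc (kept-injective xs c eq)
kept-injective (x ∷ xs) (false ∷ c) {suc i} {suc j} eq = cong suc (kept-injective xs c (suc-injective eq))
kept-injective (x ∷ xs) (true ∷ c)  {zero}  {_}     {()}
kept-injective (x ∷ xs) (true ∷ c)  {suc i} {zero}  {_} {()}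

origin : (xs : List A) (c : Subset (length xs)) → Fin (length (removeEdges xs c)) → Fin (length xs)
origin []       []          ()
origin (x ∷ xs) (true ∷ c)  e       = suc (origin xs c e)
origin (x ∷ xs) (false ∷ c) zero    = zero
origin (x ∷ xs) (false ∷ c) (suc e) = suc (origin xs c e)

lookup-origin : (xs : List A) (c : Subset (length xs)) → ∀ e →
                lookup xs (origin xs c e) ≡ lookup (removeEdges xs c) e
lookup-origin []       []          ()
lookup-origin (x ∷ xs) (true ∷ c)  e       = lookup-origin xs c e
lookup-origin (x ∷ xs) (false ∷ c) zero    = refl
lookup-origin (x ∷ xs) (false ∷ c) (suc e) = lookup-origin xs c e

origin-outside : (xs : List A) (c : Subset (length xs)) → ∀ e → Vec.lookup c (origin xs c e) ≡ false
origin-outside []       []          ()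
origin-outside (x ∷ xs) (true ∷ c)  e       = origin-outside xs c e
origin-outside (x ∷ xs) (false ∷ c) zero    = refl
origin-outside (x ∷ xs) (false ∷ c) (suc e) = origin-outside xs c e

origin-injective : (xs : List A) (c : Subset (length xs)) → Injective _≡_ _≡_ (origin xs c)
origin-injective []       []          {()}
origin-injective (x ∷ xs) (true ∷ c)  eq = origin-injective xs c (suc-injective eq)
origin-injective (x ∷ xs) (false ∷ c) {zero}  {zero}  eq = refl
origin-injective (x ∷ xs) (false ∷ c) {suc e} {suc e'} eq = cong suc (origin-injective xs c (suc-injective eq))

lookup-tabulate-cast : ∀ {n} (f : Fin n → A) i → lookup (tabulate f) i ≡ f (cast (length-tabulate f) i)
lookup-tabulate-cast {n = suc n} f zero    = refl
lookup-tabulate-cast {n = suc n} f (suc i) = lookup-tabulate-cast (λ j → f (suc j)) i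

lookup-allFin-injective : ∀ n → Injective _≡_ _≡_ (lookup (allFin n))
lookup-allFin-injective n {i} {j} eq = toℕ-injective (begin
  toℕ i                             ≡⟨ toℕ-cast (length-tabulate id) i ⟨
  toℕ (cast (length-tabulate id) i) ≡⟨ cong toℕ cast-i≡cast-j ⟩
  toℕ (cast (length-tabulate id) j) ≡⟨ toℕ-cast (length-tabulate id) j ⟩
  toℕ j                             ∎)
  where
    open ≡-Reasoning
    cast-i≡cast-j = trans (sym (lookup-tabulate-cast id i)) (trans eq (lookup-tabulate-cast id j))

-- Finite sums

⟦_⟧ : Bool → ℕ
⟦ true ⟧  = 1
⟦ false ⟧ = 0

⟦∨⟧≤ : ∀ a b → ⟦ a ∨ b ⟧ ≤ ⟦ a ⟧ + ⟦ b ⟧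
⟦∨⟧≤ true  b = s≤s z≤n
⟦∨⟧≤ false b = ≤-refl

∨≡false : ∀ a b → a ∨ b ≡ false → a ≡ false × b ≡ false
∨≡false false b eq = refl , eq

⟦⟧≤1 : ∀ a → ⟦ a ⟧ ≤ 1
⟦⟧≤1 true  = ≤-refl
⟦⟧≤1 false = z≤n

∑-mono-≤ : ∀ {n} {f g : Fin n → ℕ} → (∀ i → f i ≤ g i) → ∑[ i < n ] f i ≤ ∑[ i < n ] g i
∑-mono-≤ {zero}  f≤g = z≤n
∑-mono-≤ {suc n} f≤g = +-mono-≤ (f≤g zero) (∑-mono-≤ (λ i → f≤g (suc i)))

term≤∑ : ∀ {n} (f : Fin n → ℕ) i → f i ≤ ∑[ j < n ] f j
term≤∑ f zero    = m≤m+n (f zero) _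
term≤∑ f (suc i) = ≤-trans (term≤∑ (λ j → f (suc j)) i) (m≤n+m _ (f zero))

∣∣≡∑ : ∀ {n} (c : Subset n) → ∣ c ∣ ≡ ∑[ i < n ] ⟦ Vec.lookup c i ⟧
∣∣≡∑ []          = refl
∣∣≡∑ (true ∷ c)  = cong suc (∣∣≡∑ c)
∣∣≡∑ (false ∷ c) = ∣∣≡∑ c

sum-map≡∑-lookup : (f : A → ℕ) (xs : List A) → sum (map f xs) ≡ ∑[ i < length xs ] f (lookup xs i)
sum-map≡∑-lookup f []       = refl
sum-map≡∑-lookup f (x ∷ xs) = cong (f x +_) (sum-map≡∑-lookup f xs)

∑-++ : (xs ys : List A) (f : Fin (length (xs ++ ys)) → ℕ) →
       ∑[ p < length (xs ++ ys) ] f p ≡ ∑[ i < length xs ] f (posˡ xs ys i) + ∑[ j < length ys ] f (posʳ xs ys j)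
∑-++ []       ys f = refl
∑-++ (x ∷ xs) ys f = trans (cong (f zero +_) (∑-++ xs ys (λ p → f (suc p)))) (sym (ℕ.+-assoc (f zero) _ _))

∑-map : (h : A → B) (xs : List A) (f : Fin (length (map h xs)) → ℕ) →
        ∑[ p < length (map h xs) ] f p ≡ ∑[ i < length xs ] f (posᵐ h xs i)
∑-map h []       f = refl
∑-map h (x ∷ xs) f = cong (f zero +_) (∑-map h xs (λ p → f (suc p)))

∑-concatMap : ∀ {n} (h : A → List B) (g : Fin n → A) (f : Fin (length (concatMap h (tabulate g))) → ℕ) →
              ∑[ p < length (concatMap h (tabulate g)) ] f p
              ≡ ∑[ j < n ] ∑[ k < length (h (g j)) ] f (posᶜ h g j k)
∑-concatMap {n = zero}  h g f = refl
∑-concatMap {n = suc n} h g f = trans (∑-++ (h (g zero)) _ f)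
  (cong (∑[ k < length (h (g zero)) ] f (posˡ (h (g zero)) _ k) +_)
        (∑-concatMap h (λ i → g (suc i)) (λ q → f (posʳ (h (g zero)) _ q))))

-- Walks and embeddings

Incident : (G : Graph) → E G → V G → Set
Incident G e v = proj₁ (ends G e) ≡ v ⊎ proj₂ (ends G e) ≡ v

walk-start-incident : ∀ {G s t vs es} → Walk G s t vs es → s ≢ t → ∃ λ e → Incident G e s
walk-start-incident nil                 s≢t = ⊥-elim (s≢t refl)
walk-start-incident (cons e (inj₁ p) w) s≢t = e , inj₁ (cong proj₁ p)
walk-start-incident (cons e (inj₂ p) w) s≢t = e , inj₂ (cong proj₂ p)

walk-end-incident : ∀ {G s t vs es} → Walk G s t vs es → s ≢ t → ∃ λ e → Incident G e t
walk-end-incident nil s≢t = ⊥-elim (s≢t refl)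
walk-end-incident {t = t} (cons {w = w} e joins rest) s≢t with w F.≟ t
... | no w≢t    = walk-end-incident rest w≢t
... | yes refl  with joins
...   | inj₁ p = e , inj₂ (cong proj₂ p)
...   | inj₂ p = e , inj₁ (cong proj₁ p)

connected-incident : (G : Graph) → Connected G → HasEdge G → ∀ u → ∃ λ e → Incident G e u
connected-incident G conn e u with u F.≟ proj₁ (ends G e)
... | yes u≡a = e , inj₁ (sym u≡a)
... | no  u≢a = walk-start-incident (proj₂ (proj₂ (conn u (proj₁ (ends G e))))) u≢a

single-edge-path : ∀ {G} e {x y} → ends G e ≡ (x , y) → x ≢ y → Path G x y (e ∷ [])
single-edge-path e ends≡ x≢y = _ , cons e (inj₁ ends≡) nil , (x≢y ∷ []) ∷ [] ∷ []

immersion-incident : ∀ {H G} → Loopless H → (∀ u → ∃ λ f → Incident H f u) →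
                     ((φ , _) : Immersion H G) → ∀ u → ∃ λ e → Incident G e (φ u)
immersion-incident H-loopless H-incident (φ , ψ , φ-injective , ψ-path , _) u with H-incident u
... | f , inj₁ refl = walk-start-incident (proj₁ (proj₂ (ψ-path f))) (H-loopless f ∘ φ-injective)
... | f , inj₂ refl = walk-end-incident (proj₁ (proj₂ (ψ-path f))) (H-loopless f ∘ φ-injective)

record Embedding (G₁ G₂ : Graph) : Set where
  field
    vertex           : V G₁ → V G₂
    edge             : E G₁ → E G₂
    vertex-injective : Injective _≡_ _≡_ vertex
    edge-injective   : Injective _≡_ _≡_ edge
    ends-edge        : ∀ e → ends G₂ (edge e) ≡ (vertex (proj₁ (ends G₁ e)) , vertex (proj₂ (ends G₁ e)))

module _ {G₁ G₂ : Graph} (ι : Embedding G₁ G₂) where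
  open Embedding ι

  walk-map : ∀ {u v vs es} → Walk G₁ u v vs es → Walk G₂ (vertex u) (vertex v) (map vertex vs) (map edge es)
  walk-map nil                 = nil
  walk-map (cons e joins w) = cons (edge e) (Sum.map (lift e) (lift e) joins) (walk-map w)
    where
      lift : ∀ e {x y} → ends G₁ e ≡ (x , y) → ends G₂ (edge e) ≡ (vertex x , vertex y)
      lift e refl = ends-edge e

  path-map : ∀ {u v es} → Path G₁ u v es → Path G₂ (vertex u) (vertex v) (map edge es)
  path-map (vs , w , unique) = map vertex vs , walk-map w , Unique.map⁺ vertex-injective unique

  edgeDisjoint-map : ∀ {es es'} → EdgeDisjoint es es' → EdgeDisjoint (map edge es) (map edge es')
  edgeDisjoint-map disjoint x∈ x∈' with ∈-map⁻ edge x∈ | ∈-map⁻ edge x∈'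
  ... | e , e∈ , refl | e' , e'∈ , eq with edge-injective eq
  ...   | refl = disjoint e∈ e'∈

-- Attaching gadgets

↑ˡ≢↑ʳ : ∀ m k (i : Fin m) (j : Fin k) → i ↑ˡ k ≢ m ↑ʳ j
↑ˡ≢↑ʳ m k i j eq with trans (sym (splitAt-↑ˡ m i k)) (trans (cong (F.splitAt m) eq) (splitAt-↑ʳ m k j))
... | ()

splitAt-injective : ∀ m {n} → Injective _≡_ _≡_ (F.splitAt m {n})
splitAt-injective m {n} {i} {j} eq =
  trans (sym (join-splitAt m n i)) (trans (cong (F.join m n) eq) (join-splitAt m n j))

join-injective : ∀ m n → Injective _≡_ _≡_ (F.join m n)
join-injective m n {x} {y} eq =
  trans (sym (splitAt-join m n x)) (trans (cong (F.splitAt m) eq) (splitAt-join m n y))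

⊎-map-injective : ∀ {A B C D : Set} {f : A → C} {g : B → D} →
                  Injective _≡_ _≡_ f → Injective _≡_ _≡_ g → Injective _≡_ _≡_ (Sum.map f g)
⊎-map-injective f-inj g-inj {inj₁ x} {inj₁ y} eq = cong inj₁ (f-inj (inj₁-injective eq))
⊎-map-injective f-inj g-inj {inj₂ x} {inj₂ y} eq = cong inj₂ (g-inj (inj₂-injective eq))

module Attach (G : Graph) (att : List (V G)) where

  private
    d = length att

  oldVertex : V G → V (attach G att)
  oldVertex v = v ↑ˡ (d + d)

  first second : Fin d → V (attach G att)
  first  j = n G ↑ʳ (j ↑ˡ d)
  second j = n G ↑ʳ (d ↑ʳ j)

  oldEnds : V G × V G → V (attach G att) × V (attach G att)
  oldEnds (a , b) = oldVertex a , oldVertex b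

  gadget : Fin d → List (V (attach G att) × V (attach G att))
  gadget j = let w = oldVertex (lookup att j) in
    (first j , second j) ∷ (first j , second j) ∷ (w , first j) ∷ (w , second j) ∷ []

  oldEdges gadgetEdges : List (V (attach G att) × V (attach G att))
  oldEdges    = map oldEnds (edges G)
  gadgetEdges = concatMap gadget (allFin d)

  oldEdge : E G → E (attach G att)
  oldEdge e = posˡ oldEdges gadgetEdges (posᵐ oldEnds (edges G) e)

  gadgetEdge : Fin d → Fin 4 → E (attach G att)
  gadgetEdge j k = posʳ oldEdges gadgetEdges (posᶜ gadget id j k)

  ends-oldEdge : ∀ e → ends (attach G att) (oldEdge e) ≡ oldEnds (ends G e)
  ends-oldEdge e = trans (lookup-posˡ oldEdges gadgetEdges _) (lookup-posᵐ oldEnds (edges G) e)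

  ends-gadgetEdge : ∀ j k → ends (attach G att) (gadgetEdge j k) ≡ lookup (gadget j) k
  ends-gadgetEdge j k = trans (lookup-posʳ oldEdges gadgetEdges _) (lookup-posᶜ gadget id j k)

  oldEdge-injective : Injective _≡_ _≡_ oldEdge
  oldEdge-injective eq = posᵐ-injective oldEnds (edges G) (posˡ-injective oldEdges gadgetEdges eq)

  gadgetEdge-injective : ∀ {j j' k k'} → gadgetEdge j k ≡ gadgetEdge j' k' → j ≡ j' × k ≡ k'
  gadgetEdge-injective eq with posᶜ-injective gadget id (posʳ-injective oldEdges gadgetEdges eq)
  ... | j≡j' , k≡k' = j≡j' , toℕ-injective k≡k'

  oldEdge≢gadgetEdge : ∀ e j k → oldEdge e ≢ gadgetEdge j k
  oldEdge≢gadgetEdge e j k = posˡ≢posʳ oldEdges gadgetEdges _ _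

  data EdgeView : E (attach G att) → Set where
    old    : ∀ e → EdgeView (oldEdge e)
    inside : ∀ j k → EdgeView (gadgetEdge j k)

  edgeView : ∀ p → EdgeView p
  edgeView p with ++-view oldEdges gadgetEdges p
  ... | inʳ q with concatMap-view gadget id q
  ...   | at j k = inside j k
  edgeView p | inˡ q with map-view oldEnds (edges G) q
  ...   | at e = old e

  ∑-edges : (f : E (attach G att) → ℕ) →
            ∑[ p < length (edges (attach G att)) ] f p
            ≡ ∑[ e < length (edges G) ] f (oldEdge e) + ∑[ j < d ] ∑[ k < 4 ] f (gadgetEdge j k)
  ∑-edges f = trans (∑-++ oldEdges gadgetEdges f)
    (cong₂ _+_ (∑-map oldEnds (edges G) _) (∑-concatMap gadget id _))

  gadget-loopless : ∀ j k → proj₁ (lookup (gadget j) k) ≢ proj₂ (lookup (gadget j) k)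
  gadget-loopless j zero                   eq = ↑ˡ≢↑ʳ d d j j (↑ʳ-injective (n G) _ _ eq)
  gadget-loopless j (suc zero)             eq = ↑ˡ≢↑ʳ d d j j (↑ʳ-injective (n G) _ _ eq)
  gadget-loopless j (suc (suc zero))       eq = ↑ˡ≢↑ʳ (n G) (d + d) _ _ eq
  gadget-loopless j (suc (suc (suc zero))) eq = ↑ˡ≢↑ʳ (n G) (d + d) _ _ eq

module AttachMap (H G : Graph) (attH : List (V H)) (attG : List (V G))
                 (φ : V H → V G) (σ : Fin (length attH) → Fin (length attG)) where

  private
    module H⁺ = Attach H attH
    module G⁺ = Attach G attG
    dH = length attH
    dG = length attG

  vertex : V (attach H attH) → V (attach G attG)
  vertex = F.join (n G) (dG + dG) ∘ Sum.map φ (F.join dG dG ∘ Sum.map σ σ ∘ F.splitAt dH) ∘ F.splitAt (n H)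

  vertex-injective : Injective _≡_ _≡_ φ → Injective _≡_ _≡_ σ → Injective _≡_ _≡_ vertex
  vertex-injective φ-inj σ-inj =
    splitAt-injective (n H) ∘ ⊎-map-injective φ-inj
      (splitAt-injective dH ∘ ⊎-map-injective σ-inj σ-inj ∘ join-injective dG dG)
    ∘ join-injective (n G) (dG + dG)

  vertex-old : ∀ u → vertex (H⁺.oldVertex u) ≡ G⁺.oldVertex (φ u)
  vertex-old u rewrite splitAt-↑ˡ (n H) u (dH + dH) = refl

  vertex-first : ∀ j → vertex (H⁺.first j) ≡ G⁺.first (σ j)
  vertex-first j rewrite splitAt-↑ʳ (n H) (dH + dH) (j ↑ˡ dH) | splitAt-↑ˡ dH j dH = refl

  vertex-second : ∀ j → vertex (H⁺.second j) ≡ G⁺.second (σ j)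
  vertex-second j rewrite splitAt-↑ʳ (n H) (dH + dH) (dH ↑ʳ j) | splitAt-↑ʳ dH dH j = refl

  vertex² : V (attach H attH) × V (attach H attH) → V (attach G attG) × V (attach G attG)
  vertex² (a , b) = vertex a , vertex b

  vertex-attached : ∀ j → lookup attG (σ j) ≡ φ (lookup attH j) →
                    vertex (H⁺.oldVertex (lookup attH j)) ≡ G⁺.oldVertex (lookup attG (σ j))
  vertex-attached j att≡ = trans (vertex-old _) (cong G⁺.oldVertex (sym att≡))

  vertex-gadget : ∀ j → lookup attG (σ j) ≡ φ (lookup attH j) → ∀ k →
                  vertex² (lookup (H⁺.gadget j) k) ≡ lookup (G⁺.gadget (σ j)) k
  vertex-gadget j att≡ zero                   = cong₂ _,_ (vertex-first j) (vertex-second j)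
  vertex-gadget j att≡ (suc zero)             = cong₂ _,_ (vertex-first j) (vertex-second j)
  vertex-gadget j att≡ (suc (suc zero))       = cong₂ _,_ (vertex-attached j att≡) (vertex-first j)
  vertex-gadget j att≡ (suc (suc (suc zero))) = cong₂ _,_ (vertex-attached j att≡) (vertex-second j)

-- Degrees

incidence : ∀ {N} → Fin N → Fin N × Fin N → ℕ
incidence v (a , b) = ⟦ ⌊ v F.≟ a ⌋ ∨ ⌊ v F.≟ b ⌋ ⟧

-- mdeg sums a function local to its definition; unification recovers that function.
private
  mdeg-summand : (G : Graph) (v : V G) → Σ (V G × V G → ℕ) λ f → mdeg G v ≡ sum (map f (edges G))
  mdeg-summand G v = _ , refl

  mdeg-summand≗incidence : (G : Graph) (v : V G) → ∀ p → proj₁ (mdeg-summand G v) p ≡ incidence v p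
  mdeg-summand≗incidence G v (a , b) with ⌊ v F.≟ a ⌋ ∨ ⌊ v F.≟ b ⌋
  ... | true  = refl
  ... | false = refl

mdeg≡∑-incidence : (G : Graph) (v : V G) → mdeg G v ≡ ∑[ e < length (edges G) ] incidence v (ends G e)
mdeg≡∑-incidence G v = begin
  mdeg G v                                          ≡⟨ proj₂ (mdeg-summand G v) ⟩
  sum (map (proj₁ (mdeg-summand G v)) (edges G))    ≡⟨ cong sum (map-cong (mdeg-summand≗incidence G v) (edges G)) ⟩
  sum (map (incidence v) (edges G))                 ≡⟨ sum-map≡∑-lookup (incidence v) (edges G) ⟩
  ∑[ e < length (edges G) ] incidence v (ends G e)  ∎
  where open ≡-Reasoning

incidence-left : ∀ {N} (a b : Fin N) → incidence a (a , b) ≡ 1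
incidence-left a b with a F.≟ a
... | yes _   = refl
... | no a≢a = ⊥-elim (a≢a refl)

incidence-right : ∀ {N} (a b : Fin N) → incidence b (a , b) ≡ 1
incidence-right a b with b F.≟ b
... | yes _   = cong ⟦_⟧ (∨-zeroʳ ⌊ b F.≟ a ⌋)
... | no b≢b = ⊥-elim (b≢b refl)

term≤∑-incidence : ∀ {N} (P : Fin N → Bool) {a b : Fin N} x → incidence x (a , b) ≡ 1 →
                   ⟦ P x ⟧ ≤ ∑[ v < N ] (⟦ P v ⟧ * incidence v (a , b))
term≤∑-incidence {N} P {a} {b} x x-incident = begin
  ⟦ P x ⟧                       ≡⟨ *-identityʳ ⟦ P x ⟧ ⟨
  ⟦ P x ⟧ * 1                   ≡⟨ cong (⟦ P x ⟧ *_) x-incident ⟨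
  ⟦ P x ⟧ * incidence x (a , b) ≤⟨ term≤∑ (λ v → ⟦ P v ⟧ * incidence v (a , b)) x ⟩
  ∑[ v < N ] (⟦ P v ⟧ * incidence v (a , b)) ∎
  where open ℕ.≤-Reasoning

endpoints≤∑-incidence : ∀ {N} (P : Fin N → Bool) (a b : Fin N) →
                        ⟦ P a ∨ P b ⟧ ≤ ∑[ v < N ] (⟦ P v ⟧ * incidence v (a , b))
endpoints≤∑-incidence P a b with P a in Pa
... | true  = subst (λ x → ⟦ x ⟧ ≤ ∑[ v < _ ] (⟦ P v ⟧ * incidence v (a , b))) Pa
                    (term≤∑-incidence P {a} {b} a (incidence-left a b))
... | false = term≤∑-incidence P {a} {b} b (incidence-right a b)

degreeSlots : (G : Graph) → List (V G)
degreeSlots G = concatMap (λ v → replicate (mdeg G v) v) (allFin (n G))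

∑-replicate : (g : A → ℕ) (r : ℕ) (x : A) → ∑[ k < length (replicate r x) ] g (lookup (replicate r x) k) ≡ r * g x
∑-replicate g zero    x = refl
∑-replicate g (suc r) x = cong (g x +_) (∑-replicate g r x)

∑-degreeSlots : (G : Graph) (g : V G → ℕ) →
                ∑[ j < length (degreeSlots G) ] g (lookup (degreeSlots G) j) ≡ ∑[ v < n G ] (mdeg G v * g v)
∑-degreeSlots G g = trans (∑-concatMap slots id (g ∘ lookup (degreeSlots G)))
  (sum-cong-≗ λ v → trans (sum-cong-≗ (λ k → cong g (lookup-posᶜ slots id v k))) (∑-replicate g (mdeg G v) v))
  where slots = λ v → replicate (mdeg G v) v

-- Every vertex v occupies at least mdeg G v positions of att (take g the indicator of v).
SlotsDominateDegrees : (G : Graph) → List (V G) → Set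
SlotsDominateDegrees G att = ∀ (g : V G → ℕ) → ∑[ v < n G ] (mdeg G v * g v) ≤ ∑[ j < length att ] g (lookup att j)

-- The projected cover

module ProjectedCover (G : Graph) (att : List (V G)) (C' : Subset (length (edges (attach G att)))) where

  open Attach G att

  cut : E (attach G att) → Bool
  cut = Vec.lookup C'

  Hit : Fin (length att) → Set
  Hit j = ∃ λ k → cut (gadgetEdge j k) ≡ true

  Alive : V G → Set
  Alive v = ∃ λ j → lookup att j ≡ v × ¬ Hit j

  opaque
    hit? : ∀ j → Dec (Hit j)
    hit? j = any? λ k → cut (gadgetEdge j k) Bool.≟ true

    alive? : ∀ v → Dec (Alive v)
    alive? v = any? λ j → (lookup att j F.≟ v) ×-dec ¬? (hit? j)

  dead : V G → Bool
  dead v = not ⌊ alive? v ⌋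

  deadEnd : E G → Bool
  deadEnd e = dead (proj₁ (ends G e)) ∨ dead (proj₂ (ends G e))

  inC : E G → Bool
  inC e = cut (oldEdge e) ∨ deadEnd e

  opaque
    C : Subset (length (edges G))
    C = Vec.tabulate inC

    lookup-C : ∀ e → Vec.lookup C e ≡ inC e
    lookup-C = lookup∘tabulate inC

  dead-slot≤hits : ∀ j → ⟦ dead (lookup att j) ⟧ ≤ ∑[ k < 4 ] ⟦ cut (gadgetEdge j k) ⟧
  dead-slot≤hits j with hit? j
  ... | yes (k , hit) = ≤-trans (⟦⟧≤1 _)
    (subst (_≤ ∑[ k < 4 ] ⟦ cut (gadgetEdge j k) ⟧) (cong ⟦_⟧ hit) (term≤∑ (λ k → ⟦ cut (gadgetEdge j k) ⟧) k))
  ... | no ¬hit with alive? (lookup att j)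
  ...   | yes _     = z≤n
  ...   | no ¬alive = ⊥-elim (¬alive (j , refl , ¬hit))

  deadEnds≤hits : SlotsDominateDegrees G att →
                  ∑[ e < length (edges G) ] ⟦ deadEnd e ⟧
                  ≤ ∑[ j < length att ] ∑[ k < 4 ] ⟦ cut (gadgetEdge j k) ⟧
  deadEnds≤hits slots = begin
    ∑[ e < m ] ⟦ deadEnd e ⟧
      ≤⟨ ∑-mono-≤ (λ e → endpoints≤∑-incidence dead (proj₁ (ends G e)) (proj₂ (ends G e))) ⟩
    ∑[ e < m ] ∑[ v < n G ] (⟦ dead v ⟧ * incidence v (ends G e))
      ≡⟨ ∑-comm (λ e v → ⟦ dead v ⟧ * incidence v (ends G e)) ⟩
    ∑[ v < n G ] ∑[ e < m ] (⟦ dead v ⟧ * incidence v (ends G e))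
      ≡⟨ sum-cong-≗ (λ v → *-distribˡ-sum ⟦ dead v ⟧ (λ e → incidence v (ends G e))) ⟨
    ∑[ v < n G ] (⟦ dead v ⟧ * ∑[ e < m ] incidence v (ends G e))
      ≡⟨ sum-cong-≗ (λ v → cong (⟦ dead v ⟧ *_) (mdeg≡∑-incidence G v)) ⟨
    ∑[ v < n G ] (⟦ dead v ⟧ * mdeg G v)
      ≡⟨ sum-cong-≗ (λ v → *-comm ⟦ dead v ⟧ (mdeg G v)) ⟩
    ∑[ v < n G ] (mdeg G v * ⟦ dead v ⟧)
      ≤⟨ slots (⟦_⟧ ∘ dead) ⟩
    ∑[ j < length att ] ⟦ dead (lookup att j) ⟧
      ≤⟨ ∑-mono-≤ dead-slot≤hits ⟩
    ∑[ j < length att ] ∑[ k < 4 ] ⟦ cut (gadgetEdge j k) ⟧ ∎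
    where
      open ℕ.≤-Reasoning
      m = length (edges G)

  ∣C∣≤∣C'∣ : SlotsDominateDegrees G att → ∣ C ∣ ≤ ∣ C' ∣
  ∣C∣≤∣C'∣ slots = begin
    ∣ C ∣
      ≡⟨ ∣∣≡∑ C ⟩
    ∑[ e < m ] ⟦ Vec.lookup C e ⟧
      ≡⟨ sum-cong-≗ (λ e → cong ⟦_⟧ (lookup-C e)) ⟩
    ∑[ e < m ] ⟦ inC e ⟧
      ≤⟨ ∑-mono-≤ (λ e → ⟦∨⟧≤ (cut (oldEdge e)) _) ⟩
    ∑[ e < m ] (⟦ cut (oldEdge e) ⟧ + ⟦ deadEnd e ⟧)
      ≡⟨ ∑-distrib-+ (λ e → ⟦ cut (oldEdge e) ⟧) (λ e → ⟦ deadEnd e ⟧) ⟩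
    ∑[ e < m ] ⟦ cut (oldEdge e) ⟧ + ∑[ e < m ] ⟦ deadEnd e ⟧
      ≤⟨ +-monoʳ-≤ (∑[ e < m ] ⟦ cut (oldEdge e) ⟧) (deadEnds≤hits slots) ⟩
    ∑[ e < m ] ⟦ cut (oldEdge e) ⟧ + ∑[ j < length att ] ∑[ k < 4 ] ⟦ cut (gadgetEdge j k) ⟧
      ≡⟨ ∑-edges (λ p → ⟦ cut p ⟧) ⟨
    ∑[ p < length (edges (attach G att)) ] ⟦ cut p ⟧
      ≡⟨ ∣∣≡∑ C' ⟨
    ∣ C' ∣ ∎
    where
      open ℕ.≤-Reasoning
      m = length (edges G)

  dead≡false⇒alive : ∀ v → dead v ≡ false → Alive v
  dead≡false⇒alive v ¬dead with alive? v
  ... | yes alive = alive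

  private
    K = attach G att ∖ C'
    attEdges = edges (attach G att)
    origin′ = origin (edges G) C

  inC≡false : ∀ e → inC e ≡ false →
              cut (oldEdge e) ≡ false × dead (proj₁ (ends G e)) ≡ false × dead (proj₂ (ends G e)) ≡ false
  inC≡false e eq with ∨≡false (cut (oldEdge e)) _ eq
  ... | cut , deads = cut , ∨≡false (dead (proj₁ (ends G e))) _ deads

  survivor-∉C : ∀ e → inC (origin′ e) ≡ false
  survivor-∉C e = trans (sym (lookup-C (origin′ e))) (origin-outside (edges G) C e)

  survivor-ends-alive : ∀ (e : E (G ∖ C)) → Alive (proj₁ (ends (G ∖ C) e)) × Alive (proj₂ (ends (G ∖ C) e))
  survivor-ends-alive e with inC≡false (origin′ e) (survivor-∉C e)
  ... | _ , dead₁ , dead₂ = subst Alive (cong proj₁ ends≡) (dead≡false⇒alive _ dead₁)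
                          , subst Alive (cong proj₂ ends≡) (dead≡false⇒alive _ dead₂)
    where ends≡ = lookup-origin (edges G) C e

  incident-alive : ∀ e {v} → Incident (G ∖ C) e v → Alive v
  incident-alive e (inj₁ refl) = proj₁ (survivor-ends-alive e)
  incident-alive e (inj₂ refl) = proj₂ (survivor-ends-alive e)

  survivor-old-∉C' : ∀ e → cut (oldEdge (origin′ e)) ≡ false
  survivor-old-∉C' e = proj₁ (inC≡false (origin′ e) (survivor-∉C e))

  survivorEdge : E (G ∖ C) → E K
  survivorEdge e = kept attEdges C' (oldEdge (origin′ e)) (survivor-old-∉C' e)

  survivors : Embedding (G ∖ C) K
  survivors = record
    { vertex           = oldVertex
    ; edge             = survivorEdge
    ; vertex-injective = ↑ˡ-injective _ _ _
    ; edge-injective   = origin-injective (edges G) C ∘ oldEdge-injective ∘ kept-injective attEdges C'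
    ; ends-edge        = λ e → trans (lookup-kept attEdges C' _ (survivor-old-∉C' e))
                                 (trans (ends-oldEdge (origin′ e)) (cong oldEnds (lookup-origin (edges G) C e)))
    }

  module Lift (H : Graph) (attH : List (V H)) (attH-injective : Injective _≡_ _≡_ (lookup attH))
              (H-loopless : Loopless H) (H-connected : Connected H) (H-edge : HasEdge H)
              (φ : V H → V G) (ψ : E H → List (E (G ∖ C))) (φ-injective : Injective _≡_ _≡_ φ)
              (ψ-path : ∀ f → Path (G ∖ C) (φ (proj₁ (ends H f))) (φ (proj₂ (ends H f))) (ψ f))
              (ψ-disjoint : ∀ f f' → f ≢ f' → EdgeDisjoint (ψ f) (ψ f')) where

    private
      module H⁺ = Attach H attH

    image-alive : ∀ u → Alive (φ u)
    image-alive u = incident-alive _ (proj₂ (immersion-incident {H} {G ∖ C} H-loopless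
      (connected-incident H H-connected H-edge) (φ , ψ , φ-injective , ψ-path , ψ-disjoint) u))

    slot : Fin (length attH) → Fin (length att)
    slot j = proj₁ (image-alive (lookup attH j))

    slot-vertex : ∀ j → lookup att (slot j) ≡ φ (lookup attH j)
    slot-vertex j = proj₁ (proj₂ (image-alive (lookup attH j)))

    slot-injective : Injective _≡_ _≡_ slot
    slot-injective eq =
      attH-injective (φ-injective (trans (sym (slot-vertex _)) (trans (cong (lookup att) eq) (slot-vertex _))))

    slot-∉C' : ∀ j k → cut (gadgetEdge (slot j) k) ≡ false
    slot-∉C' j k = ¬-not λ hit → proj₂ (proj₂ (image-alive (lookup attH j))) (k , hit)

    open AttachMap H G attH att φ slot

    gadgetEdge⁺ : Fin (length attH) → Fin 4 → E K
    gadgetEdge⁺ j k = kept attEdges C' (gadgetEdge (slot j) k) (slot-∉C' j k)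

    route : E (attach H attH) → List (E K)
    route p with H⁺.edgeView p
    ... | H⁺.old f      = map survivorEdge (ψ f)
    ... | H⁺.inside j k = gadgetEdge⁺ j k ∷ []

    Route : E (attach H attH) → List (E K) → Set
    Route p = Path K (proj₁ (vertex² (ends (attach H attH) p))) (proj₂ (vertex² (ends (attach H attH) p)))

    old-route : ∀ f → Route (H⁺.oldEdge f) (map survivorEdge (ψ f))
    old-route f = subst (λ (x , y) → Path K x y _) ends≡ (path-map survivors (ψ-path f))
      where
        ends≡ : oldEnds (φ (proj₁ (ends H f)) , φ (proj₂ (ends H f)))
                ≡ vertex² (ends (attach H attH) (H⁺.oldEdge f))
        ends≡ = sym (trans (cong vertex² (H⁺.ends-oldEdge f)) (cong₂ _,_ (vertex-old _) (vertex-old _)))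

    gadget-route : ∀ j k → Route (H⁺.gadgetEdge j k) (gadgetEdge⁺ j k ∷ [])
    gadget-route j k = single-edge-path (gadgetEdge⁺ j k) ends≡
      λ x≡y → gadget-loopless (slot j) k (trans (sym (cong proj₁ ends≡′)) (trans x≡y (cong proj₂ ends≡′)))
      where
        ends≡′ : vertex² (ends (attach H attH) (H⁺.gadgetEdge j k)) ≡ lookup (gadget (slot j)) k
        ends≡′ = trans (cong vertex² (H⁺.ends-gadgetEdge j k)) (vertex-gadget j (slot-vertex j) k)
        ends≡ : ends K (gadgetEdge⁺ j k) ≡ vertex² (ends (attach H attH) (H⁺.gadgetEdge j k))
        ends≡ = trans (lookup-kept attEdges C' _ (slot-∉C' j k))
                      (trans (ends-gadgetEdge (slot j) k) (sym ends≡′))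

    route-path : ∀ p → Route p (route p)
    route-path p with H⁺.edgeView p
    ... | H⁺.old f      = old-route f
    ... | H⁺.inside j k = gadget-route j k

    old-gadget-disjoint : ∀ f j k → EdgeDisjoint (map survivorEdge (ψ f)) (gadgetEdge⁺ j k ∷ [])
    old-gadget-disjoint f j k x∈ (here refl) with ∈-map⁻ survivorEdge x∈
    ... | e , _ , eq = oldEdge≢gadgetEdge (origin′ e) (slot j) k
                         (sym (kept-injective attEdges C' {gadgetEdge (slot j) k} {oldEdge (origin′ e)} eq))

    gadget-gadget-disjoint : ∀ j k j' k' → H⁺.gadgetEdge j k ≢ H⁺.gadgetEdge j' k' →
                             EdgeDisjoint (gadgetEdge⁺ j k ∷ []) (gadgetEdge⁺ j' k' ∷ [])
    gadget-gadget-disjoint j k j' k' ≢ (here refl) (here eq)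
      with gadgetEdge-injective {slot j} {slot j'} {k} {k'}
             (kept-injective attEdges C' {p = slot-∉C' j k} {q = slot-∉C' j' k'} eq)
    ... | slot≡ , refl = ≢ (cong (λ j → H⁺.gadgetEdge j k) (slot-injective slot≡))

    route-disjoint : ∀ p p' → p ≢ p' → EdgeDisjoint (route p) (route p')
    route-disjoint p p' p≢p' with H⁺.edgeView p | H⁺.edgeView p'
    ... | H⁺.old f      | H⁺.old f'        = edgeDisjoint-map survivors (ψ-disjoint f f' (p≢p' ∘ cong H⁺.oldEdge))
    ... | H⁺.old f      | H⁺.inside j k    = old-gadget-disjoint f j k
    ... | H⁺.inside j k | H⁺.old f         = λ x∈ x∈' → old-gadget-disjoint f j k x∈' x∈
    ... | H⁺.inside j k | H⁺.inside j' k'  = gadget-gadget-disjoint j k j' k' p≢p'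

    lift : Immersion (attach H attH) K
    lift = vertex , route , vertex-injective φ-injective slot-injective , route-path , route-disjoint

  C-isCover : (H : Graph) (attH : List (V H)) → Injective _≡_ _≡_ (lookup attH) →
              Loopless H → Connected H → HasEdge H →
              IsCover (attach H attH) (attach G att) C' → IsCover H G C
  C-isCover H attH attH-injective H-loopless H-connected H-edge C'-cover
            (φ , ψ , φ-injective , ψ-path , ψ-disjoint) = C'-cover (Lift.lift H attH attH-injective H-loopless H-connected H-edge φ ψ φ-injective ψ-path ψ-disjoint)

lemma7 : (H G : Graph) → Loopless H → Loopless G → Connected H → HasEdge H →
    (k k' : ℕ) → IsCoverNumber H G k → IsCoverNumber (H ⁺) (G *) k' → k ≤ k'
lemma7 H G H-loopless _ H-connected H-edge k k' (_ , k-minimal) ((C' , C'-cover , ∣C'∣≡k') , _) = begin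
  k      ≤⟨ k-minimal C C-cover ⟩
  ∣ C ∣  ≤⟨ ∣C∣≤∣C'∣ (λ g → ≤-reflexive (sym (∑-degreeSlots G g))) ⟩
  ∣ C' ∣ ≡⟨ ∣C'∣≡k' ⟩
  k'     ∎
  where
    open ProjectedCover G (degreeSlots G) C'
    open ℕ.≤-Reasoning
    C-cover = C-isCover H (allFin (n H)) (lookup-allFin-injective (n H)) H-loopless H-connected H-edge C'-cover
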